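{- Let $p$ be a prime, $\mathbb F=\mathbb F_p$, and let $X\subseteq\mathbb F^\times$ be a nonempty subset with $1\notin X$ (so that $1-X=\{1-x:x\in X\}\subseteq\mathbb F^\times$). Then: (1) if $\mathrm{rad}(X)\neq\{1\}$, then $\mathrm{rad}(1-X)=\{1\}$; (2) if $X$ is of group type, then $1-X$ is of group type only if $X=\mathbb F^\times\setminus\{1\}$.
   Context: For a subset $Y$ of the (cyclic) multiplicative group $\mathbb F^\times$, the radical $\mathrm{rad}(Y)$ is the subgroup of all $y\in\mathbb F^\times$ with $yY=Y$. A nonempty subset $Y\subseteq\mathbb F^\times$ with $1\notin Y$ is of group type if $Y\cup\{1\}$ is a multiplicative subgroup of $\mathbb F^\times$. -}

module Defs where

open import Level using (0ℓ)
open import Data.Nat using (ℕ; _+_; _*_; _∸_; _≤_; _<_; NonZero; _%_)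
open import Data.Product using (Σ; ∃; _×_)
open import Relation.Binary.PropositionalEquality using (_≡_; _≢_)
open import Relation.Nullary using (¬_)
open import Relation.Unary using (Pred; _∈_; _∉_)
open import Function.Bundles using (_⇔_)

-- Elements of 𝔽_p are represented by their canonical residues 0,…,p-1 (natural
-- numbers < p); field multiplication and subtraction are computed mod p.
-- Subsets of 𝔽_p are predicates on ℕ (only residues < p are relevant).

module _ (p : ℕ) .{{_ : NonZero p}} where

  Units : Pred ℕ 0ℓ
  Units x = 1 ≤ x × x < p

  mulF : ℕ → ℕ → ℕ
  mulF x y = (x * y) % p

  -- 1 - x in 𝔽_p (for a residue x < p)
  oneMinus : ℕ → ℕ
  oneMinus x = (1 + p ∸ x) % p

  _≐_ : Pred ℕ 0ℓ → Pred ℕ 0ℓ → Set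
  A ≐ B = ∀ w → (w ∈ A) ⇔ (w ∈ B)

  scale : ℕ → Pred ℕ 0ℓ → Pred ℕ 0ℓ
  scale y Y w = ∃ λ z → z ∈ Y × w ≡ mulF y z

  oneMinusSet : Pred ℕ 0ℓ → Pred ℕ 0ℓ
  oneMinusSet Y w = ∃ λ z → z ∈ Y × w ≡ oneMinus z

  rad : Pred ℕ 0ℓ → Pred ℕ 0ℓ
  rad Y y = y ∈ Units × scale y Y ≐ Y

  TrivialSet : Pred ℕ 0ℓ
  TrivialSet w = w ≡ 1

  UnitsMinusOne : Pred ℕ 0ℓ
  UnitsMinusOne w = w ∈ Units × w ≢ 1

  withOne : Pred ℕ 0ℓ → Pred ℕ 0ℓ
  withOne Y w = w ∈ Y ⊎' w ≡ 1
    where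
    open import Data.Sum using () renaming (_⊎_ to _⊎'_)

  record IsSubgroup (S : Pred ℕ 0ℓ) : Set where
    field
      ⊆units  : ∀ x → x ∈ S → x ∈ Units
      one∈    : 1 ∈ S
      mulClosed : ∀ x y → x ∈ S → y ∈ S → mulF x y ∈ S
      invClosed : ∀ x → x ∈ S → ∃ λ y → y ∈ S × mulF x y ≡ 1

  record GroupType (Y : Pred ℕ 0ℓ) : Set where
    field
      nonempty : ∃ λ y → y ∈ Y
      one∉     : 1 ∉ Y
      subgroup : IsSubgroup (withOne Y)

module Submission where

-- Work in ℤ modulo p. (1) If u ≠ 1 stabilises X and w ≠ 1 stabilises 1 - X, then X is
-- stable under x ↦ u x and x ↦ 1 - w (1 - x), hence under their commutator, which is the
-- translation by (1 - w) (u - 1) ≠ 0. A nonempty set stable under a nonzero translation is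
-- all of 𝔽_p, so it would contain 0.
-- (2) If X ∪ {1} and (1 - X) ∪ {1} are groups, then 1 / (1 - 1 / (1 - 1 / x)) = 1 - x
-- shows 1 - X ⊆ X, and (1 - 1 / x) / ((1 - x) / x) = -1 puts -1 in X ∪ {1}. So X ∪ {1} is
-- closed under x ↦ -x and, whenever -x ≠ 1, under x ↦ 1 - (-x) = 1 + x; starting from 1
-- it contains 1, 2, …, p - 1.

open import Level using (0ℓ)
open import Data.Nat as ℕ using (ℕ; zero; suc; NonZero; _<_; _≤_; _%_; _∸_; _≟_; s≤s; z≤n)
import Data.Nat.Properties as ℕ
open import Data.Nat.DivMod using (m<n⇒m%n≡m; m%n<n)
open import Data.Nat.Divisibility using (n∣m⇒m%n≡0)
open import Data.Nat.Primality using (Prime; prime⇒nonZero; prime⇒nonTrivial)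
open import Data.Nat.Coprimality using (prime⇒coprime; coprime-Bézout)
open import Data.Nat.GCD using (module Bézout)
open import Data.Integer using (ℤ; +_; 0ℤ; 1ℤ; -1ℤ; _+_; _*_; -_; _-_; ∣_∣; _%ℕ_; _/ℕ_)
open import Data.Integer.Properties
  using (*-commutativeSemigroup; +-identityʳ; +-inverseʳ; +-minus-telescope; *-identityˡ; *-identityʳ; *-zeroʳ; *-assoc; +-injective; pos-*; i-j≡0⇒i≡j; ∣i∣≡0⇒i≡0; [+m]-[+n]≡m⊖n; ∣m⊝n∣≤m⊔n; ⊖-≥)
open import Algebra.Properties.CommutativeSemigroup *-commutativeSemigroup using (xy∙z≈xz∙y)
open import Data.Integer.DivMod using (a≡a%ℕn+[a/ℕn]*n; n%ℕd<d)
open import Data.Integer.Divisibility.Signed using (_∣_; divides; ∣⇒∣ᵤ; ∣m∣n⇒∣m+n; ∣m⇒∣-m; ∣n⇒∣m*n; ∣m⇒∣m*n)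
open import Data.Integer.Tactic.RingSolver using (solve-∀)
open import Data.Product using (∃; _×_; _,_; proj₁; proj₂; map₂)
open import Data.Empty using (⊥)
open import Data.Sum using (inj₁; inj₂)
open import Function.Bundles using (mk⇔; Equivalence)
open import Relation.Binary.Bundles using (Setoid)
open import Relation.Binary.Definitions using (Symmetric; Transitive; _Respects_)
open import Relation.Binary.Structures using (IsEquivalence)
open import Relation.Binary.PropositionalEquality using (_≡_; _≢_; refl; sym; trans; cong; subst; module ≡-Reasoning)
import Relation.Binary.Reasoning.Setoid as SetoidReasoning
open import Relation.Nullary using (¬_; contradiction)
open import Relation.Nullary.Decidable using (decidable-stable)
open import Relation.Unary using (Pred; _∈_; _∉_; _⊆_)

open import Defs

module Congruence (p : ℕ) .{{_ : NonZero p}} where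

  infix 4 _≋_
  record _≋_ (a b : ℤ) : Set where
    constructor mk≋
    field p∣a-b : + p ∣ a - b

  ≡⇒≋ : ∀ {a b} → a ≡ b → a ≋ b
  ≡⇒≋ {a} refl = mk≋ (subst (+ p ∣_) (sym (+-inverseʳ a)) (divides 0ℤ refl))

  ≋-refl : ∀ {a} → a ≋ a
  ≋-refl = ≡⇒≋ refl

  ≋-sym : Symmetric _≋_
  ≋-sym {a} {b} (mk≋ a≋b) = mk≋ (subst (+ p ∣_) (negate a b) (∣m⇒∣-m a≋b))
    where
    negate : ∀ a b → - (a - b) ≡ b - a
    negate = solve-∀

  ≋-trans : Transitive _≋_
  ≋-trans {a} {b} {c} (mk≋ a≋b) (mk≋ b≋c) = mk≋ (subst (+ p ∣_) (+-minus-telescope a b c) (∣m∣n⇒∣m+n a≋b b≋c))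

  ≋-isEquivalence : IsEquivalence _≋_
  ≋-isEquivalence = record { refl = ≋-refl ; sym = ≋-sym ; trans = ≋-trans }

  ≋-setoid : Setoid 0ℓ 0ℓ
  ≋-setoid = record { isEquivalence = ≋-isEquivalence }

  module ≋-Reasoning = SetoidReasoning ≋-setoid

  +-cong : ∀ {a b c d} → a ≋ b → c ≋ d → a + c ≋ b + d
  +-cong {a} {b} {c} {d} (mk≋ a≋b) (mk≋ c≋d) = mk≋ (subst (+ p ∣_) (regroup a b c d) (∣m∣n⇒∣m+n a≋b c≋d))
    where
    regroup : ∀ a b c d → (a - b) + (c - d) ≡ (a + c) - (b + d)
    regroup = solve-∀

  *-cong : ∀ {a b c d} → a ≋ b → c ≋ d → a * c ≋ b * d
  *-cong {a} {b} {c} {d} (mk≋ a≋b) (mk≋ c≋d) =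
    mk≋ (subst (+ p ∣_) (regroup a b c d) (∣m∣n⇒∣m+n (∣m⇒∣m*n c a≋b) (∣n⇒∣m*n b c≋d)))
    where
    regroup : ∀ a b c d → (a - b) * c + b * (c - d) ≡ a * c - b * d
    regroup = solve-∀

  -‿cong : ∀ {a b} → a ≋ b → - a ≋ - b
  -‿cong {a} {b} (mk≋ a≋b) = mk≋ (subst (+ p ∣_) (negate a b) (∣m⇒∣-m a≋b))
    where
    negate : ∀ a b → - (a - b) ≡ - a - - b
    negate = solve-∀

  -cong : ∀ {a b c d} → a ≋ b → c ≋ d → a - c ≋ b - d
  -cong a≋b c≋d = +-cong a≋b (-‿cong c≋d)

  1-cong : ∀ {a b} → a ≋ b → 1ℤ - a ≋ 1ℤ - b
  1-cong = -cong (≋-refl {1ℤ})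

  p≋0 : + p ≋ 0ℤ
  p≋0 = mk≋ (divides 1ℤ (trans (+-identityʳ (+ p)) (sym (*-identityˡ (+ p)))))

  %ℕ-≋ : ∀ a → + (a %ℕ p) ≋ a
  %ℕ-≋ a = ≋-sym (mk≋ (divides (a /ℕ p) (begin
    a - + (a %ℕ p)                              ≡⟨ cong (_- + (a %ℕ p)) (a≡a%ℕn+[a/ℕn]*n a p) ⟩
    + (a %ℕ p) + (a /ℕ p) * + p - + (a %ℕ p)    ≡⟨ cancel (+ (a %ℕ p)) _ ⟩
    (a /ℕ p) * + p                              ∎)))
    where
    open ≡-Reasoning
    cancel : ∀ r q → r + q - r ≡ q
    cancel = solve-∀

  residue-injective : ∀ {m n} → m < p → n < p → + m ≋ + n → m ≡ n
  residue-injective {m} {n} m<p n<p (mk≋ p∣m-n) =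
    +-injective (i-j≡0⇒i≡j (+ m) (+ n) (∣i∣≡0⇒i≡0 ∣m-n∣≡0))
    where
    ∣m-n∣<p : ∣ + m - + n ∣ < p
    ∣m-n∣<p = ℕ.≤-<-trans (ℕ.≤-reflexive (cong ∣_∣ ([+m]-[+n]≡m⊖n m n)))
                         (ℕ.≤-<-trans (∣m⊝n∣≤m⊔n m n) (ℕ.⊔-lub m<p n<p))
    ∣m-n∣≡0 : ∣ + m - + n ∣ ≡ 0
    ∣m-n∣≡0 = trans (sym (m<n⇒m%n≡m ∣m-n∣<p)) (n∣m⇒m%n≡0 _ p (∣⇒∣ᵤ p∣m-n))

  nonzero-residue : ∀ {n} → 0 < n → n < p → ¬ + n ≋ 0ℤ
  nonzero-residue 0<n n<p n≋0 = ℕ.<⇒≢ 0<n (sym (residue-injective n<p (ℕ.<-trans 0<n n<p) n≋0))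

  -≋0⇒≋ : ∀ {a b} → a - b ≋ 0ℤ → a ≋ b
  -≋0⇒≋ {a} {b} (mk≋ p∣a-b) = mk≋ (subst (+ p ∣_) (+-identityʳ (a - b)) p∣a-b)

  mulF-≋ : ∀ x y → + mulF p x y ≋ + x * + y
  mulF-≋ x y = ≋-trans (%ℕ-≋ (+ (x ℕ.* y))) (≡⇒≋ (pos-* x y))

  oneMinus-≋ : ∀ {x} → x ≤ p → + oneMinus p x ≋ 1ℤ - + x
  oneMinus-≋ {x} x≤p = begin
    + oneMinus p x        ≈⟨ %ℕ-≋ (+ (1 ℕ.+ p ∸ x)) ⟩
    + (1 ℕ.+ p ∸ x)       ≡⟨ sym (trans ([+m]-[+n]≡m⊖n (1 ℕ.+ p) x) (⊖-≥ (ℕ.m≤n⇒m≤1+n x≤p))) ⟩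
    1ℤ + + p - + x        ≈⟨ -cong (+-cong (≋-refl {1ℤ}) p≋0) (≋-refl {+ x}) ⟩
    1ℤ + 0ℤ - + x         ≡⟨⟩
    1ℤ - + x              ∎
    where open ≋-Reasoning

  record Invariant (f : ℤ → ℤ) (S : Pred ℤ 0ℓ) : Set where
    field
      image    : ∀ {a} → a ∈ S → f a ∈ S
      preimage : ∀ {a} → a ∈ S → ∃ λ c → c ∈ S × f c ≋ a

  commutator-translation : ∀ {S u w} → S Respects _≋_
    → Invariant (u *_) S → Invariant (λ a → 1ℤ - w * (1ℤ - a)) S
    → ∀ {a} → a ∈ S → a + (1ℤ - w) * (u - 1ℤ) ∈ S
  commutator-translation {S} {u} {w} S-resp scaling affine {a} a∈S with Invariant.preimage affine a∈S
  ... | b , b∈S , wb≋a with Invariant.preimage scaling b∈S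
  ... | c , c∈S , uc≋b = S-resp u[wc]≋a+τ (Invariant.image scaling (Invariant.image affine c∈S))
    where
    open ≋-Reasoning
    commute : ∀ u w c → u * (1ℤ - w * (1ℤ - c)) ≡ (1ℤ - w * (1ℤ - u * c)) + (1ℤ - w) * (u - 1ℤ)
    commute = solve-∀
    τ : ℤ
    τ = (1ℤ - w) * (u - 1ℤ)
    u[wc]≋a+τ : u * (1ℤ - w * (1ℤ - c)) ≋ a + τ
    u[wc]≋a+τ = begin
      u * (1ℤ - w * (1ℤ - c))          ≡⟨ commute u w c ⟩
      (1ℤ - w * (1ℤ - u * c)) + τ      ≈⟨ +-cong (1-cong (*-cong (≋-refl {w}) (1-cong uc≋b))) (≋-refl {τ}) ⟩
      (1ℤ - w * (1ℤ - b)) + τ          ≈⟨ +-cong wb≋a (≋-refl {τ}) ⟩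
      a + τ                            ∎

  translation-iterate : ∀ {S : Pred ℤ 0ℓ} {t} → S Respects _≋_ → (∀ {a} → a ∈ S → a + t ∈ S)
    → ∀ k {a} → a ∈ S → a + + k * t ∈ S
  translation-iterate S-resp step zero {a} a∈S = S-resp (≡⇒≋ (sym (+-identityʳ a))) a∈S
  translation-iterate {t = t} S-resp step (suc k) {a} a∈S =
    S-resp (≡⇒≋ (regroup a (+ k) t)) (step (translation-iterate S-resp step k a∈S))
    where
    regroup : ∀ a k t → a + k * t + t ≡ a + (1ℤ + k) * t
    regroup = solve-∀

  module _ (p-prime : Prime p) where

    bézout⇒inverse : ∀ {r} → Bézout.Identity 1 p r → ∃ λ k → + k * + r ≋ 1ℤ
    bézout⇒inverse {r} (Bézout.-+ x y 1+xp≡yr) = y , mk≋ (divides (+ x) (begin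
      + y * + r - 1ℤ          ≡⟨ cong (_- 1ℤ) (trans (sym (pos-* y r)) (cong +_ (sym 1+xp≡yr))) ⟩
      1ℤ + + (x ℕ.* p) - 1ℤ   ≡⟨ cancel (+ (x ℕ.* p)) ⟩
      + (x ℕ.* p)             ≡⟨ pos-* x p ⟩
      + x * + p               ∎))
      where
      open ≡-Reasoning
      cancel : ∀ q → 1ℤ + q - 1ℤ ≡ q
      cancel = solve-∀
    bézout⇒inverse {r} (Bézout.+- x y 1+yr≡xp) = y ℕ.* m , (begin
      + (y ℕ.* m) * + r       ≡⟨ trans (cong (_* + r) (pos-* y m)) (xy∙z≈xz∙y (+ y) (+ m) (+ r)) ⟩
      (+ y * + r) * + m       ≈⟨ *-cong yr≋-1 (%ℕ-≋ -1ℤ) ⟩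
      -1ℤ * -1ℤ               ≡⟨⟩
      1ℤ                      ∎)
      where
      open ≋-Reasoning
      m : ℕ
      m = -1ℤ %ℕ p
      yr≋-1 : + y * + r ≋ -1ℤ
      yr≋-1 = mk≋ (divides (+ x) (trans (cong (_+ 1ℤ) (sym (pos-* y r)))
                (trans (cong +_ (trans (ℕ.+-comm (y ℕ.* r) 1) 1+yr≡xp)) (pos-* x p))))

    invertible : ∀ {a} → ¬ a ≋ 0ℤ → ∃ λ k → + k * a ≋ 1ℤ
    invertible {a} a≉0 = map₂ (λ {k} → ≋-trans (*-cong (≋-refl {+ k}) (≋-sym (%ℕ-≋ a))))
      (bézout⇒inverse (coprime-Bézout (prime⇒coprime p-prime {{ℕ.≢-nonZero residue≢0}} (n%ℕd<d a p))))
      where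
      residue≢0 : a %ℕ p ≢ 0
      residue≢0 r≡0 = a≉0 (≋-sym (subst (λ r → + r ≋ a) r≡0 (%ℕ-≋ a)))

    *-≉0 : ∀ {a b} → ¬ a ≋ 0ℤ → ¬ b ≋ 0ℤ → ¬ a * b ≋ 0ℤ
    *-≉0 {a} {b} a≉0 b≉0 ab≋0 = b≉0 (cancel (invertible a≉0))
      where
      open ≋-Reasoning
      cancel : (∃ λ k → + k * a ≋ 1ℤ) → b ≋ 0ℤ
      cancel (k , ka≋1) = begin
        b                 ≡⟨ sym (*-identityˡ b) ⟩
        1ℤ * b            ≈⟨ *-cong (≋-sym ka≋1) (≋-refl {b}) ⟩
        + k * a * b       ≡⟨ *-assoc (+ k) a b ⟩
        + k * (a * b)     ≈⟨ *-cong (≋-refl {+ k}) ab≋0 ⟩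
        + k * 0ℤ          ≡⟨ *-zeroʳ (+ k) ⟩
        0ℤ                ∎

    multiple-≋ : ∀ {t} → ¬ t ≋ 0ℤ → ∀ s → ∃ λ k → + k * t ≋ s
    multiple-≋ {t} t≉0 s = rescale (invertible t≉0)
      where
      open ≋-Reasoning
      m : ℕ
      m = s %ℕ p
      rescale : (∃ λ k → + k * t ≋ 1ℤ) → ∃ λ k → + k * t ≋ s
      rescale (k , kt≋1) = k ℕ.* m , (begin
        + (k ℕ.* m) * t    ≡⟨ trans (cong (_* t) (pos-* k m)) (xy∙z≈xz∙y (+ k) (+ m) t) ⟩
        + k * t * + m      ≈⟨ *-cong kt≋1 (%ℕ-≋ s) ⟩
        1ℤ * s             ≡⟨ *-identityˡ s ⟩
        s                  ∎)

    translation-closed⇒full : ∀ {S : Pred ℤ 0ℓ} {t} → S Respects _≋_ → ¬ t ≋ 0ℤ → (∀ {a} → a ∈ S → a + t ∈ S)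
      → ∀ {a} → a ∈ S → ∀ b → b ∈ S
    translation-closed⇒full {S} {t} S-resp t≉0 step {a} a∈S b = reach (multiple-≋ t≉0 (b - a))
      where
      open ≋-Reasoning
      cancel : ∀ a b → a + (b - a) ≡ b
      cancel = solve-∀
      reach : (∃ λ k → + k * t ≋ b - a) → b ∈ S
      reach (k , kt≋b-a) = S-resp a+kt≋b (translation-iterate S-resp step k a∈S)
        where
        a+kt≋b : a + + k * t ≋ b
        a+kt≋b = begin
          a + + k * t      ≈⟨ +-cong (≋-refl {a}) kt≋b-a ⟩
          a + (b - a)      ≡⟨ cancel a b ⟩
          b                ∎

module ResidueSets (p : ℕ) .{{_ : NonZero p}} where
  open Congruence p

  Reduced : Pred ℕ 0ℓ → Set
  Reduced X = X ⊆ (_< p)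

  -- A set of residues, viewed as a ≋-closed set of integers so that the algebra can be done in ℤ.
  ⟦_⟧ : Pred ℕ 0ℓ → Pred ℤ 0ℓ
  ⟦ X ⟧ a = ∃ λ x → x ∈ X × + x ≋ a

  ⟦⟧-respects-≋ : ∀ {X} → ⟦ X ⟧ Respects _≋_
  ⟦⟧-respects-≋ a≋b (x , x∈X , x≋a) = x , x∈X , ≋-trans x≋a a≋b

  ∈⟦⟧ : ∀ {X x} → x ∈ X → + x ∈ ⟦ X ⟧
  ∈⟦⟧ x∈X = _ , x∈X , ≋-refl

  ⟦⟧-reduced : ∀ {X n} → Reduced X → n < p → + n ∈ ⟦ X ⟧ → n ∈ X
  ⟦⟧-reduced {X} X<p n<p (x , x∈X , x≋n) = subst X (residue-injective (X<p x∈X) n<p x≋n) x∈X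

  1∈⟦withOne⟧ : ∀ {X} → 1ℤ ∈ ⟦ withOne p X ⟧
  1∈⟦withOne⟧ = ∈⟦⟧ (inj₂ refl)

  ⟦⟧⊆⟦withOne⟧ : ∀ {X} → ⟦ X ⟧ ⊆ ⟦ withOne p X ⟧
  ⟦⟧⊆⟦withOne⟧ (x , x∈X , x≋a) = x , inj₁ x∈X , x≋a

  ⟦withOne⟧-≉1 : ∀ {X a} → a ∈ ⟦ withOne p X ⟧ → ¬ a ≋ 1ℤ → a ∈ ⟦ X ⟧
  ⟦withOne⟧-≉1 (x , inj₁ x∈X , x≋a) _   = x , x∈X , x≋a
  ⟦withOne⟧-≉1 (_ , inj₂ refl , 1≋a) a≉1 = contradiction (≋-sym 1≋a) a≉1

  oneMinusSet-reduced : ∀ {X} → Reduced (oneMinusSet p X)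
  oneMinusSet-reduced (x , _ , refl) = m%n<n _ p

  ⟦⟧⇒⟦oneMinusSet⟧ : ∀ {X a} → Reduced X → a ∈ ⟦ X ⟧ → 1ℤ - a ∈ ⟦ oneMinusSet p X ⟧
  ⟦⟧⇒⟦oneMinusSet⟧ X<p (x , x∈X , x≋a) =
    oneMinus p x , (x , x∈X , refl) , ≋-trans (oneMinus-≋ (ℕ.<⇒≤ (X<p x∈X))) (1-cong x≋a)

  ⟦oneMinusSet⟧⇒⟦⟧ : ∀ {X a} → Reduced X → a ∈ ⟦ oneMinusSet p X ⟧ → 1ℤ - a ∈ ⟦ X ⟧
  ⟦oneMinusSet⟧⇒⟦⟧ {X} {a} X<p (_ , (x , x∈X , refl) , 1-x≋a) = x , x∈X , (begin
    + x                        ≡⟨ involutive (+ x) ⟩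
    1ℤ - (1ℤ - + x)            ≈⟨ 1-cong (≋-sym (oneMinus-≋ (ℕ.<⇒≤ (X<p x∈X)))) ⟩
    1ℤ - + oneMinus p x        ≈⟨ 1-cong 1-x≋a ⟩
    1ℤ - a                     ∎)
    where
    open ≋-Reasoning
    involutive : ∀ a → a ≡ 1ℤ - (1ℤ - a)
    involutive = solve-∀

  ⟦⟧-mulClosed : ∀ {S a b} → IsSubgroup p S → a ∈ ⟦ S ⟧ → b ∈ ⟦ S ⟧ → a * b ∈ ⟦ S ⟧
  ⟦⟧-mulClosed S-subgroup (x , x∈S , x≋a) (y , y∈S , y≋b) =
    mulF p x y , IsSubgroup.mulClosed S-subgroup x y x∈S y∈S , ≋-trans (mulF-≋ x y) (*-cong x≋a y≋b)

  ⟦⟧-invClosed : ∀ {S a} → IsSubgroup p S → a ∈ ⟦ S ⟧ → ∃ λ b → b ∈ ⟦ S ⟧ × a * b ≋ 1ℤ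
  ⟦⟧-invClosed S-subgroup (x , x∈S , x≋a) with IsSubgroup.invClosed S-subgroup x x∈S
  ... | y , y∈S , xy≡1 = + y , ∈⟦⟧ y∈S ,
    ≋-trans (*-cong (≋-sym x≋a) (≋-refl {+ y})) (≋-trans (≋-sym (mulF-≋ x y)) (≡⇒≋ (cong +_ xy≡1)))

  ⟦⟧-inverse : ∀ {Y a} → 1 < p → Reduced Y → GroupType p Y → a ∈ ⟦ Y ⟧ → ∃ λ b → b ∈ ⟦ Y ⟧ × a * b ≋ 1ℤ
  ⟦⟧-inverse {Y} {a} 1<p Y<p Y-groupType a∈Y =
    exclude-1 (⟦⟧-invClosed (GroupType.subgroup Y-groupType) (⟦⟧⊆⟦withOne⟧ a∈Y))
    where
    exclude-1 : (∃ λ b → b ∈ ⟦ withOne p Y ⟧ × a * b ≋ 1ℤ) → ∃ λ b → b ∈ ⟦ Y ⟧ × a * b ≋ 1ℤ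
    exclude-1 (b , b∈Y∪1 , ab≋1) = b , ⟦withOne⟧-≉1 b∈Y∪1 b≉1 , ab≋1
      where
      open ≋-Reasoning
      b≉1 : ¬ b ≋ 1ℤ
      b≉1 b≋1 = GroupType.one∉ Y-groupType (⟦⟧-reduced Y<p 1<p (⟦⟧-respects-≋ a≋1 a∈Y))
        where
        a≋1 : a ≋ 1ℤ
        a≋1 = begin
          a        ≡⟨ sym (*-identityʳ a) ⟩
          a * 1ℤ   ≈⟨ *-cong (≋-refl {a}) (≋-sym b≋1) ⟩
          a * b    ≈⟨ ab≋1 ⟩
          1ℤ       ∎

  1∈rad : ∀ {Y} → 1 < p → Reduced Y → 1 ∈ rad p Y
  1∈rad {Y} 1<p Y<p = (ℕ.≤-refl , 1<p) , λ y → mk⇔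
    (λ { (z , z∈Y , y≡1z) → subst Y (sym (trans y≡1z (1·z≡z (Y<p z∈Y)))) z∈Y })
    (λ y∈Y → y , y∈Y , sym (1·z≡z (Y<p y∈Y)))
    where
    1·z≡z : ∀ {z} → z < p → mulF p 1 z ≡ z
    1·z≡z {z} z<p = trans (cong (_% p) (ℕ.*-identityˡ z)) (m<n⇒m%n≡m z<p)

  rad⇒invariant : ∀ {Y u} → u ∈ rad p Y → Invariant (+ u *_) ⟦ Y ⟧
  rad⇒invariant {Y} {u} (_ , uY≐Y) = record { image = image ; preimage = preimage }
    where
    image : ∀ {a} → a ∈ ⟦ Y ⟧ → + u * a ∈ ⟦ Y ⟧
    image (y , y∈Y , y≋a) =
      mulF p u y , Equivalence.to (uY≐Y _) (y , y∈Y , refl) , ≋-trans (mulF-≋ u y) (*-cong (≋-refl {+ u}) y≋a)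
    preimage : ∀ {a} → a ∈ ⟦ Y ⟧ → ∃ λ c → c ∈ ⟦ Y ⟧ × + u * c ≋ a
    preimage (y , y∈Y , y≋a) with Equivalence.from (uY≐Y y) y∈Y
    ... | z , z∈Y , y≡uz = + z , ∈⟦⟧ z∈Y , ≋-trans (≋-sym (mulF-≋ u z)) (subst (λ v → + v ≋ _) y≡uz y≋a)

  invariant-oneMinusSet : ∀ {X f} → Reduced X
    → Invariant f ⟦ oneMinusSet p X ⟧ → Invariant (λ a → 1ℤ - f (1ℤ - a)) ⟦ X ⟧
  invariant-oneMinusSet {X} {f} X<p f-inv = record { image = image ; preimage = preimage }
    where
    open Invariant f-inv renaming (image to f-image; preimage to f-preimage)
    image : ∀ {a} → a ∈ ⟦ X ⟧ → 1ℤ - f (1ℤ - a) ∈ ⟦ X ⟧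
    image a∈X = ⟦oneMinusSet⟧⇒⟦⟧ X<p (f-image (⟦⟧⇒⟦oneMinusSet⟧ X<p a∈X))
    preimage : ∀ {a} → a ∈ ⟦ X ⟧ → ∃ λ c → c ∈ ⟦ X ⟧ × 1ℤ - f (1ℤ - c) ≋ a
    preimage {a} a∈X with f-preimage (⟦⟧⇒⟦oneMinusSet⟧ X<p a∈X)
    ... | c , c∈1-X , fc≋1-a = 1ℤ - c , ⟦oneMinusSet⟧⇒⟦⟧ X<p c∈1-X , (begin
      1ℤ - f (1ℤ - (1ℤ - c))   ≡⟨ cong (λ x → 1ℤ - f x) (involutive c) ⟩
      1ℤ - f c                 ≈⟨ 1-cong fc≋1-a ⟩
      1ℤ - (1ℤ - a)            ≡⟨ involutive a ⟩
      a                        ∎)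
      where
      open ≋-Reasoning
      involutive : ∀ a → 1ℤ - (1ℤ - a) ≡ a
      involutive = solve-∀

module _ (p : ℕ) (p-prime : Prime p) where
  private instance
    p≢0 : NonZero p
    p≢0 = prime⇒nonZero p-prime
  open Congruence p
  open ResidueSets p

  1<p : 1 < p
  1<p = ℕ.nonTrivial⇒n>1 p {{prime⇒nonTrivial p-prime}}

  units-reduced : ∀ {X} → X ⊆ Units p → Reduced X
  units-reduced X⊆U x∈X = proj₂ (X⊆U x∈X)

  radicals-not-both-nontrivial : ∀ {X u w} → X ⊆ Units p → (∃ λ x → x ∈ X)
    → u ∈ rad p X → u ≢ 1 → w ∈ rad p (oneMinusSet p X) → w ≢ 1 → ⊥
  radicals-not-both-nontrivial {X} {u} {w} X⊆U (x , x∈X) u∈rad u≢1 w∈rad w≢1 = 0∉⟦X⟧ (⟦X⟧-full 0ℤ)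
    where
    X<p : Reduced X
    X<p = units-reduced X⊆U
    τ≉0 : ¬ (1ℤ - + w) * (+ u - 1ℤ) ≋ 0ℤ
    τ≉0 = *-≉0 p-prime
      (λ 1-w≋0 → w≢1 (sym (residue-injective 1<p (proj₂ (proj₁ w∈rad)) (-≋0⇒≋ 1-w≋0))))
      (λ u-1≋0 → u≢1 (residue-injective (proj₂ (proj₁ u∈rad)) 1<p (-≋0⇒≋ u-1≋0)))
    ⟦X⟧-full : ∀ b → b ∈ ⟦ X ⟧
    ⟦X⟧-full = translation-closed⇒full p-prime ⟦⟧-respects-≋ τ≉0
      (commutator-translation {u = + u} {w = + w} ⟦⟧-respects-≋
        (rad⇒invariant u∈rad) (invariant-oneMinusSet X<p (rad⇒invariant w∈rad)))
      (∈⟦⟧ x∈X)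
    0∉⟦X⟧ : 0ℤ ∉ ⟦ X ⟧
    0∉⟦X⟧ (y , y∈X , y≋0) = nonzero-residue (proj₁ (X⊆U y∈X)) (X<p y∈X) y≋0

  rad≐TrivialSet : ∀ {Y} → Reduced Y → (∀ {u} → u ∈ rad p Y → u ≢ 1 → ⊥) → _≐_ p (rad p Y) (TrivialSet p)
  rad≐TrivialSet Y<p nontrivial⇒⊥ u = mk⇔
    (λ u∈rad → decidable-stable (u ≟ 1) (nontrivial⇒⊥ u∈rad))
    (λ { refl → 1∈rad 1<p Y<p })

  rad-nontrivial⇒rad-oneMinusSet-trivial : ∀ {X} → X ⊆ Units p → (∃ λ x → x ∈ X)
    → ¬ (_≐_ p (rad p X) (TrivialSet p)) → _≐_ p (rad p (oneMinusSet p X)) (TrivialSet p)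
  rad-nontrivial⇒rad-oneMinusSet-trivial X⊆U X≢∅ rad≢1 =
    rad≐TrivialSet oneMinusSet-reduced λ w∈rad w≢1 →
      rad≢1 (rad≐TrivialSet (units-reduced X⊆U) λ u∈rad u≢1 →
        radicals-not-both-nontrivial X⊆U X≢∅ u∈rad u≢1 w∈rad w≢1)

  module BothGroupType {X} (X⊆U : X ⊆ Units p) (X-groupType : GroupType p X)
                       (1-X-groupType : GroupType p (oneMinusSet p X)) where
    open GroupType X-groupType using (one∉) renaming (nonempty to X≢∅; subgroup to H-subgroup)

    X<p : Reduced X
    X<p = units-reduced X⊆U

    H : Pred ℕ 0ℓ
    H = withOne p X

    complement : ∀ {z} → z ∈ ⟦ X ⟧ → 1ℤ - z ∈ ⟦ X ⟧
    complement {z} z∈X =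
      let y , y∈X , zy≋1     = ⟦⟧-inverse 1<p X<p X-groupType z∈X
          e , e∈1-X , [1-y]e≋1 = ⟦⟧-inverse 1<p oneMinusSet-reduced 1-X-groupType (⟦⟧⇒⟦oneMinusSet⟧ X<p y∈X)
          t , t∈X , [1-e]t≋1 = ⟦⟧-inverse 1<p X<p X-groupType (⟦oneMinusSet⟧⇒⟦⟧ X<p e∈1-X)
      in ⟦⟧-respects-≋ (cycle {z} {y} {e} {t} zy≋1 [1-y]e≋1 [1-e]t≋1) t∈X
      where
      expand : ∀ z y e t → z * y * t ≡ z * (t - (1ℤ - y) * e * t - (1ℤ - y) * ((1ℤ - e) * t))
      expand = solve-∀
      collect : ∀ z y t → z * (t - 1ℤ * t - (1ℤ - y) * 1ℤ) ≡ z * y - z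
      collect = solve-∀
      -- x ↦ 1 / (1 - x) has order three.
      cycle : ∀ {z y e t} → z * y ≋ 1ℤ → (1ℤ - y) * e ≋ 1ℤ → (1ℤ - e) * t ≋ 1ℤ → t ≋ 1ℤ - z
      cycle {z} {y} {e} {t} zy≋1 [1-y]e≋1 [1-e]t≋1 = begin
        t                                                        ≡⟨ sym (*-identityˡ t) ⟩
        1ℤ * t                                                   ≈⟨ *-cong (≋-sym zy≋1) (≋-refl {t}) ⟩
        z * y * t                                                ≡⟨ expand z y e t ⟩
        z * (t - (1ℤ - y) * e * t - (1ℤ - y) * ((1ℤ - e) * t))   ≈⟨ *-cong (≋-refl {z}) (-cong
            (-cong (≋-refl {t}) (*-cong [1-y]e≋1 (≋-refl {t}))) (*-cong (≋-refl {1ℤ - y}) [1-e]t≋1)) ⟩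
        z * (t - 1ℤ * t - (1ℤ - y) * 1ℤ)                         ≡⟨ collect z y t ⟩
        z * y - z                                                ≈⟨ -cong zy≋1 (≋-refl {z}) ⟩
        1ℤ - z                                                   ∎
        where open ≋-Reasoning

    -1∈⟦H⟧ : -1ℤ ∈ ⟦ H ⟧
    -1∈⟦H⟧ =
      let x , x∈X           = X≢∅
          i , i∈X , xi≋1     = ⟦⟧-inverse 1<p X<p X-groupType (∈⟦⟧ x∈X)
          [1-x]i∈H          = ⟦⟧-mulClosed H-subgroup (⟦⟧⊆⟦withOne⟧ (complement (∈⟦⟧ x∈X))) (⟦⟧⊆⟦withOne⟧ i∈X)
          e , e∈H , [1-x]ie≋1 = ⟦⟧-invClosed H-subgroup [1-x]i∈H
      in ⟦⟧-respects-≋ ([1-i]e≋-1 {+ x} {i} {e} xi≋1 [1-x]ie≋1)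
                       (⟦⟧-mulClosed H-subgroup (⟦⟧⊆⟦withOne⟧ (complement i∈X)) e∈H)
      where
      regroup : ∀ x i e → (1ℤ - i) * e ≡ (1ℤ - x * i) * e - (1ℤ - x) * i * e
      regroup = solve-∀
      [1-i]e≋-1 : ∀ {x i e} → x * i ≋ 1ℤ → (1ℤ - x) * i * e ≋ 1ℤ → (1ℤ - i) * e ≋ -1ℤ
      [1-i]e≋-1 {x} {i} {e} xi≋1 [1-x]ie≋1 = begin
        (1ℤ - i) * e                          ≡⟨ regroup x i e ⟩
        (1ℤ - x * i) * e - (1ℤ - x) * i * e   ≈⟨ -cong (*-cong (1-cong xi≋1) (≋-refl {e})) [1-x]ie≋1 ⟩
        (1ℤ - 1ℤ) * e - 1ℤ                    ≡⟨⟩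
        -1ℤ                                   ∎
        where open ≋-Reasoning

    1+-closed : ∀ {a} → a ∈ ⟦ H ⟧ → ¬ 1ℤ + a ≋ 0ℤ → 1ℤ + a ∈ ⟦ H ⟧
    1+-closed {a} a∈H 1+a≉0 =
      ⟦⟧⊆⟦withOne⟧ (⟦⟧-respects-≋ (≡⇒≋ (1-[-a]≡1+a a)) (complement (⟦withOne⟧-≉1 -a∈H -a≉1)))
      where
      1-[-a]≡1+a : ∀ a → 1ℤ - -1ℤ * a ≡ 1ℤ + a
      1-[-a]≡1+a = solve-∀
      -a∈H : -1ℤ * a ∈ ⟦ H ⟧
      -a∈H = ⟦⟧-mulClosed H-subgroup -1∈⟦H⟧ a∈H
      -a≉1 : ¬ -1ℤ * a ≋ 1ℤ
      -a≉1 -a≋1 = 1+a≉0 (begin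
        1ℤ + a            ≡⟨ sym (1-[-a]≡1+a a) ⟩
        1ℤ - -1ℤ * a      ≈⟨ 1-cong -a≋1 ⟩
        0ℤ                ∎)
        where open ≋-Reasoning

    units⊆⟦H⟧ : ∀ n → suc n < p → + suc n ∈ ⟦ H ⟧
    units⊆⟦H⟧ zero    _     = 1∈⟦withOne⟧
    units⊆⟦H⟧ (suc n) 2+n<p =
      1+-closed (units⊆⟦H⟧ n (ℕ.<-trans (ℕ.n<1+n (suc n)) 2+n<p)) (nonzero-residue (s≤s z≤n) 2+n<p)

    X≐UnitsMinusOne : _≐_ p X (UnitsMinusOne p)
    X≐UnitsMinusOne w = mk⇔ (λ w∈X → X⊆U w∈X , λ { refl → one∉ w∈X }) (from w)
      where
      from : ∀ w → w ∈ UnitsMinusOne p → w ∈ X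
      from zero    ((() , _) , _)
      from (suc n) ((_ , 1+n<p) , 1+n≢1) = ⟦⟧-reduced X<p 1+n<p
        (⟦withOne⟧-≉1 (units⊆⟦H⟧ n 1+n<p) (λ 1+n≋1 → 1+n≢1 (residue-injective 1+n<p 1<p 1+n≋1)))

lemma4p2 : (p : ℕ) (pr : Prime p) (X : Pred ℕ 0ℓ)
    → (∀ x → x ∈ X → x ∈ Units p {{prime⇒nonZero pr}})
    → (∃ λ x → x ∈ X)
    → 1 ∉ X
    → ((¬ (_≐_ p {{prime⇒nonZero pr}} (rad p {{prime⇒nonZero pr}} X) (TrivialSet p {{prime⇒nonZero pr}})))
        → _≐_ p {{prime⇒nonZero pr}} (rad p {{prime⇒nonZero pr}} (oneMinusSet p {{prime⇒nonZero pr}} X)) (TrivialSet p {{prime⇒nonZero pr}}))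
      × (GroupType p {{prime⇒nonZero pr}} X
        → GroupType p {{prime⇒nonZero pr}} (oneMinusSet p {{prime⇒nonZero pr}} X)
        → _≐_ p {{prime⇒nonZero pr}} X (UnitsMinusOne p {{prime⇒nonZero pr}}))
lemma4p2 p pr X X⊆U X≢∅ _ =
  rad-nontrivial⇒rad-oneMinusSet-trivial p pr (λ {x} → X⊆U x) X≢∅ ,
  λ X-groupType 1-X-groupType → BothGroupType.X≐UnitsMinusOne p pr (λ {x} → X⊆U x) X-groupType 1-X-groupType
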